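{- Let $G$ be a connected graph and let $C_r=v_1v_2\cdots v_rv_1$ with $r\ge 5$ be an end-block of $G$ attached to the rest of $G$ at $v_1$ (so $v_2,\dots,v_r$ have degree $2$ in $G$), with $d_G(v_1)\ge 2$. Let $G_0$ be the subgraph of $G$ obtained by deleting $v_2,\dots,v_r$, and $m=|E(G_0)|$. Let $G' = G - v_{r-1}v_r - v_2v_3 + v_{r-1}v_1 + v_3v_1$. Then $W_e(G')<W_e(G)$.
   Context: For a connected graph $G$ and edges $f=u_1u_2$, $g=v_1v_2$, $d_G(f,g)=\min\{d_G(u_i,v_j): i,j\in\{1,2\}\}+1$ if $f\neq g$, and $d_G(f,f)=0$; $W_e(G)=\sum_{\{f,g\}\subseteq E(G)} d_G(f,g)$ over unordered pairs of edges. $G-e$ and $G+e$ denote deleting and adding an edge $e$. -}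

module Defs where

open import Data.Bool using (Bool; true; false; _∧_; _∨_; not; if_then_else_; T)
open import Data.Nat using (ℕ; zero; suc; _+_; _∸_; _≤_; _<_; _⊓_)
open import Data.Nat.Base using (_<ᵇ_)
open import Data.Fin using (Fin; toℕ)
open import Data.Fin.Properties using (_≟_)
open import Data.List using (List; []; _∷_; [_]; _++_; map; concatMap; allFin)
open import Data.Bool.ListAction using (any)
open import Data.Nat.ListAction using (sum)
open import Data.Product using (_×_; _,_; ∃-syntax; proj₁; proj₂)
open import Relation.Nullary.Decidable using (⌊_⌋)
open import Relation.Binary.PropositionalEquality using (_≡_)

Adj : ℕ → Set
Adj n = Fin n → Fin n → Bool

Symmetric : ∀ {n} → Adj n → Set
Symmetric {n} A = (x y : Fin n) → A x y ≡ A y x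

Loopless : ∀ {n} → Adj n → Set
Loopless {n} A = (x : Fin n) → A x x ≡ false

_==_ : ∀ {n} → Fin n → Fin n → Bool
x == y = ⌊ x ≟ y ⌋

samePair : ∀ {n} → Fin n → Fin n → Fin n → Fin n → Bool
samePair x y a b = ((x == a) ∧ (y == b)) ∨ ((x == b) ∧ (y == a))

deleteEdge : ∀ {n} → Fin n → Fin n → Adj n → Adj n
deleteEdge a b A x y = if samePair x y a b then false else A x y

addEdge : ∀ {n} → Fin n → Fin n → Adj n → Adj n
addEdge a b A x y = if samePair x y a b then true else A x y

reach : ∀ {n} → Adj n → ℕ → Fin n → Fin n → Bool
reach A zero u v = u == v
reach {n} A (suc k) u v = reach A k u v ∨ any (λ w → reach A k u w ∧ A w v) (allFin n)

Connected : ∀ {n} → Adj n → Set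
Connected {n} A = (u v : Fin n) → ∃[ k ] T (reach A k u v)

-- least k < b with f k, and b if there is none
search : (ℕ → Bool) → ℕ → ℕ
search f zero = zero
search f (suc b) = if f zero then zero else suc (search (λ k → f (suc k)) b)

-- distance d_G(u,v) = least k such that a walk of length ≤ k exists;
-- in a connected graph on n vertices this is < n, so searching up to n suffices.
dist : ∀ {n} → Adj n → Fin n → Fin n → ℕ
dist {n} A u v = search (λ k → reach A k u v) n

degree : ∀ {n} → Adj n → Fin n → ℕ
degree {n} A v = sum (map (λ w → if A v w then 1 else 0) (allFin n))

Edge : ℕ → Set
Edge n = Fin n × Fin n

edges : ∀ {n} → Adj n → List (Edge n)
edges {n} A = concatMap (λ i → concatMap (λ j →
  if (toℕ i <ᵇ toℕ j) ∧ A i j then [ (i , j) ] else []) (allFin n)) (allFin n)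

edgeDist : ∀ {n} → Adj n → Edge n → Edge n → ℕ
edgeDist A (u₁ , u₂) (v₁ , v₂) =
  if samePair u₁ u₂ v₁ v₂ then 0
  else suc ((dist A u₁ v₁ ⊓ dist A u₁ v₂) ⊓ (dist A u₂ v₁ ⊓ dist A u₂ v₂))

pairs : {X : Set} → List X → List (X × X)
pairs [] = []
pairs (x ∷ xs) = map (λ y → (x , y)) xs ++ pairs xs

We : ∀ {n} → Adj n → ℕ
We A = sum (map (λ p → edgeDist A (proj₁ p) (proj₂ p)) (pairs (edges A)))

-- Let ψ fold v₂ and v_r onto v₁. Every edge of G goes under ψ to an edge of G′ or
-- to a single vertex, so ψ does not increase distances from G to G′. The edges that
-- G and G′ share are mapped into themselves, v_{r-1}v_r into v_{r-1}v₁ and v₂v₃ into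
-- v₃v₁, so matching E(G) with E(G′) in this way no pair of edges gets farther apart,
-- while the disjoint pair {v_{r-1}v_r, v₂v₃} (distance ≥ 2) becomes the adjacent
-- pair {v_{r-1}v₁, v₃v₁} (distance 1).
module Submission where

open import Defs
open import Algebra.Properties.CommutativeSemigroup using (interchange; x∙yz≈y∙xz)
open import Data.Bool using (Bool; true; false; T; _∧_; _∨_; if_then_else_)
open import Data.Bool.Properties using (T-∧; T-∨; T-≡; ∨-zeroʳ)
open import Data.Empty using (⊥-elim)
open import Data.Fin using (Fin; toℕ)
open import Data.Fin.Properties using (_≟_; toℕ-injective)
open import Data.List using (List; []; _∷_; [_]; _++_; map; concatMap; filter; cartesianProduct; allFin)
open import Data.List.Membership.Propositional using (_∈_; lose)
open import Data.List.Relation.Binary.Permutation.Propositional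
  using (_↭_; refl; prep; swap) renaming (trans to ↭-trans)
open import Data.List.Relation.Binary.Permutation.Propositional.Properties using (map⁺)
open import Data.List.Membership.Propositional.Properties
  using (∈-allFin; ∈-filter⁺; ∈-filter⁻; ∈-cartesianProduct⁺)
open import Data.List.Relation.Unary.Any using (here; there; satisfied)
open import Data.List.Relation.Unary.Any.Properties using (any⁺; any⁻)
open import Data.List.Relation.Unary.Unique.Propositional using (Unique)
import Data.List.Relation.Unary.All as All
open import Data.List.Relation.Unary.AllPairs using (_∷_)
open import Data.List.Membership.Propositional.Properties.WithK using (unique∧set⇒bag)
open import Data.List.Relation.Binary.BagAndSetEquality using (∼bag⇒↭)
open import Data.List.Relation.Unary.Unique.Propositional.Properties
  using (filter⁺; cartesianProduct⁺; allFin⁺)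
open import Data.List.Properties using (map-++; map-∘; filter-++)
open import Data.Nat.Base using (_<ᵇ_)
open import Data.Nat using (ℕ; zero; suc; _+_; _∸_; _≤_; _<_; z≤n; s≤s; _⊓_)
open import Data.Nat.ListAction using (sum)
open import Data.Nat.ListAction.Properties using (sum-++; sum-↭)
open import Data.Nat.Properties
  using (≤-refl; ≤-trans; ≤-<-trans; ≤-reflexive; <-asym; <-cmp; <ᵇ⇒<; <⇒<ᵇ; ≮⇒≥; _<?_; <⇒≢;
         suc-injective; m≤m+n; m≤n+m; n≤1+n; +-monoʳ-≤; +-mono-≤; +-mono-<-≤;
         ⊓-glb; m⊓n≤m; m⊓n≤n; ⊓-commutativeSemigroup; +-commutativeSemigroup; module ≤-Reasoning)
open import Data.Product using (_×_; _,_; proj₁; proj₂; ∃-syntax)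
open import Data.Sum using (_⊎_; inj₁; inj₂)
open import Data.Unit using (tt)
open import Function.Base using (_∘_)
open import Function.Bundles using (_⇔_; mk⇔; Equivalence)
open import Relation.Nullary using (¬_; Dec; yes; no)
open import Relation.Binary using (tri<; tri≈; tri>)
open import Relation.Nullary.Decidable using (T?; map′; toWitness; fromWitness)
open import Relation.Binary.PropositionalEquality
  using (_≡_; _≢_; refl; sym; trans; cong; cong₂; subst; ≢-sym)
open import Relation.Binary.PropositionalEquality.Properties using (module ≡-Reasoning)

open Equivalence using (to; from)

variable
  n : ℕ
  x y a b : Fin n

T-⇔⇒≡ : {p q : Bool} → (T p → T q) → (T q → T p) → p ≡ q
T-⇔⇒≡ {false} {false} _ _ = refl
T-⇔⇒≡ {false} {true}  _ g = ⊥-elim (g tt)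
T-⇔⇒≡ {true}  {false} f _ = ⊥-elim (f tt)
T-⇔⇒≡ {true}  {true}  _ _ = refl

==-refl : (x : Fin n) → (x == x) ≡ true
==-refl x = to T-≡ (fromWitness refl)

==-≢ : x ≢ y → (x == y) ≡ false
==-≢ x≢y = T-⇔⇒≡ (λ t → ⊥-elim (x≢y (toWitness t))) (λ ())

==-sound : (x y : Fin n) → T (x == y) → x ≡ y
==-sound x y = toWitness {a? = x ≟ y}

data _≐_ {n : ℕ} : Edge n → Edge n → Set where
  ≐-same : (x , y) ≐ (x , y)
  ≐-flip : (x , y) ≐ (y , x)

T-samePair : (x y a b : Fin n) → T (samePair x y a b) ⇔ (x , y) ≐ (a , b)
T-samePair x y a b = mk⇔ sound complete
  where
  sound : T (samePair x y a b) → (x , y) ≐ (a , b)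
  sound t with to T-∨ t
  ... | inj₁ t₁ with ==-sound x a (proj₁ (to T-∧ t₁)) | ==-sound y b (proj₂ (to T-∧ t₁))
  ...   | refl | refl = ≐-same
  sound t | inj₂ t₂ with ==-sound x b (proj₁ (to T-∧ t₂)) | ==-sound y a (proj₂ (to T-∧ t₂))
  ...   | refl | refl = ≐-flip
  complete : (x , y) ≐ (a , b) → T (samePair x y a b)
  complete ≐-same rewrite ==-refl x | ==-refl y = tt
  complete ≐-flip rewrite ==-refl x | ==-refl y | ∨-zeroʳ ((x == y) ∧ (y == x)) = tt

_≐?_ : (f g : Edge n) → Dec (f ≐ g)
(x , y) ≐? (a , b) = map′ (to (T-samePair x y a b)) (from (T-samePair x y a b)) (T? (samePair x y a b))

samePair-true : (x , y) ≐ (a , b) → samePair x y a b ≡ true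
samePair-true {x = x} {y} {a} {b} s = to T-≡ (from (T-samePair x y a b) s)

samePair-false : ¬ (x , y) ≐ (a , b) → samePair x y a b ≡ false
samePair-false {x = x} {y} {a} {b} ¬s = T-⇔⇒≡ (λ t → ¬s (to (T-samePair x y a b) t)) (λ ())

≐-swapˡ : (x , y) ≐ (a , b) → (y , x) ≐ (a , b)
≐-swapˡ ≐-same = ≐-flip
≐-swapˡ ≐-flip = ≐-same

≐-sym : (x , y) ≐ (a , b) → (a , b) ≐ (x , y)
≐-sym ≐-same = ≐-same
≐-sym ≐-flip = ≐-flip

≐-trans : {e f g : Edge n} → e ≐ f → f ≐ g → e ≐ g
≐-trans ≐-same fg = fg
≐-trans ≐-flip ≐-same = ≐-flip
≐-trans ≐-flip ≐-flip = ≐-same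

samePair-swapˡ : (x y a b : Fin n) → samePair y x a b ≡ samePair x y a b
samePair-swapˡ x y a b = T-⇔⇒≡
  (λ t → from (T-samePair x y a b) (≐-swapˡ (to (T-samePair y x a b) t)))
  (λ t → from (T-samePair y x a b) (≐-swapˡ (to (T-samePair x y a b) t)))

samePair-sym : (x y a b : Fin n) → samePair a b x y ≡ samePair x y a b
samePair-sym x y a b = T-⇔⇒≡
  (λ t → from (T-samePair x y a b) (≐-sym (to (T-samePair a b x y) t)))
  (λ t → from (T-samePair a b x y) (≐-sym (to (T-samePair x y a b) t)))

module _ (B : Adj n) where

  reach-suc : ∀ k u v → T (reach B k u v) → T (reach B (suc k) u v)
  reach-suc k u v t = from T-∨ (inj₁ t)

  reach-snoc : ∀ k u w v → T (reach B k u w) → T (B w v) → T (reach B (suc k) u v)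
  reach-snoc k u w v t e = from (T-∨ {reach B k u v})
    (inj₂ (any⁺ _ (lose (∈-allFin w) (from T-∧ (t , e)))))

  reach-suc⁻ : ∀ k u v → T (reach B (suc k) u v) →
    T (reach B k u v) ⊎ ∃[ w ] T (reach B k u w) × T (B w v)
  reach-suc⁻ k u v t with to (T-∨ {reach B k u v}) t
  ... | inj₁ t₁ = inj₁ t₁
  ... | inj₂ t₂ with satisfied (any⁻ _ (allFin n) t₂)
  ...   | w , tw = inj₂ (w , to T-∧ tw)

  reach-cons : ∀ k u w v → T (B u w) → T (reach B k w v) → T (reach B (suc k) u v)
  reach-cons zero u w v e t with ==-sound w v t
  ... | refl = reach-snoc zero u u w (from T-≡ (==-refl u)) e
  reach-cons (suc k) u w v e t with reach-suc⁻ k w v t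
  ... | inj₁ t₁ = reach-suc (suc k) u v (reach-cons k u w v e t₁)
  ... | inj₂ (x , t₂ , e₂) = reach-snoc (suc k) u x v (reach-cons k u w x e t₂) e₂

  reach-sym : Symmetric B → ∀ k u v → T (reach B k u v) → T (reach B k v u)
  reach-sym sy zero u v t with ==-sound u v t
  ... | refl = t
  reach-sym sy (suc k) u v t with reach-suc⁻ k u v t
  ... | inj₁ t₁ = reach-suc k v u (reach-sym sy k u v t₁)
  ... | inj₂ (w , t₂ , e) = reach-cons k v w u (subst T (sy w v) e) (reach-sym sy k u w t₂)

WeakHom : Adj n → Adj n → (Fin n → Fin n) → Set
WeakHom {n} B C ψ = (x y : Fin n) → T (B x y) → ψ x ≡ ψ y ⊎ T (C (ψ x) (ψ y))

reach-weakHom : (B C : Adj n) (ψ : Fin n → Fin n) → WeakHom B C ψ →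
  ∀ k u v → T (reach B k u v) → T (reach C k (ψ u) (ψ v))
reach-weakHom B C ψ hom zero u v t with ==-sound u v t
... | refl = from T-≡ (==-refl (ψ u))
reach-weakHom B C ψ hom (suc k) u v t with reach-suc⁻ B k u v t
... | inj₁ t₁ = reach-suc C k (ψ u) (ψ v) (reach-weakHom B C ψ hom k u v t₁)
... | inj₂ (w , t₂ , e) with hom w v e | reach-weakHom B C ψ hom k u w t₂
...   | inj₁ ψw≡ψv | r = reach-suc C k (ψ u) (ψ v) (subst (λ z → T (reach C k (ψ u) z)) ψw≡ψv r)
...   | inj₂ c     | r = reach-snoc C k (ψ u) (ψ w) (ψ v) r c

search-≤-witness : (f : ℕ → Bool) (b k : ℕ) → T (f k) → search f b ≤ k
search-≤-witness f zero k t = z≤n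
search-≤-witness f (suc b) k t with f zero in eq
... | true = z≤n
search-≤-witness f (suc b) zero t | false with () ← trans (sym eq) (to T-≡ t)
search-≤-witness f (suc b) (suc k) t | false = s≤s (search-≤-witness (λ j → f (suc j)) b k t)

search-found : (f : ℕ → Bool) (b : ℕ) → search f b < b → T (f (search f b))
search-found f (suc b) lt with f zero in eq
... | true = from T-≡ eq
... | false with s≤s lt′ ← lt = search-found (λ j → f (suc j)) b lt′

search-≤-bound : (f : ℕ → Bool) (b : ℕ) → search f b ≤ b
search-≤-bound f zero = z≤n
search-≤-bound f (suc b) with f zero
... | true = z≤n
... | false = s≤s (search-≤-bound (λ j → f (suc j)) b)

search-cong : (f g : ℕ → Bool) (b : ℕ) → (∀ k → f k ≡ g k) → search f b ≡ search g b
search-cong f g zero f≗g = refl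
search-cong f g (suc b) f≗g rewrite f≗g zero with g zero
... | true = refl
... | false = cong suc (search-cong (λ j → f (suc j)) (λ j → g (suc j)) b (λ k → f≗g (suc k)))

dist-weakHom : (B C : Adj n) (ψ : Fin n → Fin n) → WeakHom B C ψ →
  ∀ u v → dist C (ψ u) (ψ v) ≤ dist B u v
dist-weakHom {n} B C ψ hom u v with dist B u v <? n
... | yes found = search-≤-witness _ n (dist B u v)
        (reach-weakHom B C ψ hom (dist B u v) u v (search-found _ n found))
-- unreachable targets get the capped value n, which also bounds the left-hand side
... | no notFound = ≤-trans (search-≤-bound _ n) (≮⇒≥ notFound)

dist-self : (B : Adj n) (u : Fin n) → dist B u u ≡ 0
dist-self {suc n} B u rewrite ==-refl u = refl

dist-≢ : (B : Adj n) (u v : Fin n) → u ≢ v → 1 ≤ dist B u v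
dist-≢ {suc n} B u v u≢v rewrite ==-≢ u≢v = s≤s z≤n

dist-sym : (B : Adj n) → Symmetric B → ∀ u v → dist B u v ≡ dist B v u
dist-sym {n} B sy u v =
  search-cong _ _ n (λ k → T-⇔⇒≡ (reach-sym B sy k u v) (reach-sym B sy k v u))

_∈ₑ_ : Fin n → Edge n → Set
x ∈ₑ (a , b) = x ≡ a ⊎ x ≡ b

∈ₑ-resp-≐ : {e f : Edge n} → e ≐ f → x ∈ₑ e → x ∈ₑ f
∈ₑ-resp-≐ ≐-same x∈ = x∈
∈ₑ-resp-≐ ≐-flip (inj₁ refl) = inj₂ refl
∈ₑ-resp-≐ ≐-flip (inj₂ refl) = inj₁ refl

minDist : Adj n → Edge n → Edge n → ℕ
minDist B (u₁ , u₂) (v₁ , v₂) = (dist B u₁ v₁ ⊓ dist B u₁ v₂) ⊓ (dist B u₂ v₁ ⊓ dist B u₂ v₂)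

minDist-≤ : (B : Adj n) (f g : Edge n) {p q : Fin n} → p ∈ₑ f → q ∈ₑ g → minDist B f g ≤ dist B p q
minDist-≤ B f g (inj₁ refl) (inj₁ refl) = ≤-trans (m⊓n≤m _ _) (m⊓n≤m _ _)
minDist-≤ B f g (inj₁ refl) (inj₂ refl) = ≤-trans (m⊓n≤m _ _) (m⊓n≤n _ _)
minDist-≤ B f g (inj₂ refl) (inj₁ refl) = ≤-trans (m⊓n≤n _ _) (m⊓n≤m _ _)
minDist-≤ B f g (inj₂ refl) (inj₂ refl) = ≤-trans (m⊓n≤n _ _) (m⊓n≤n _ _)

minDist-glb : (B : Adj n) (f g : Edge n) {k : ℕ} →
  (∀ {p q} → p ∈ₑ f → q ∈ₑ g → k ≤ dist B p q) → k ≤ minDist B f g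
minDist-glb B f g k≤ = ⊓-glb (⊓-glb (k≤ (inj₁ refl) (inj₁ refl)) (k≤ (inj₁ refl) (inj₂ refl)))
                             (⊓-glb (k≤ (inj₂ refl) (inj₁ refl)) (k≤ (inj₂ refl) (inj₂ refl)))

edgeDist-≡ : (B : Adj n) (f g : Edge n) → ¬ f ≐ g → edgeDist B f g ≡ suc (minDist B f g)
edgeDist-≡ B (u₁ , u₂) (v₁ , v₂) f≭g rewrite samePair-false f≭g = refl

edgeDist-≐ : (B : Adj n) (f g : Edge n) → f ≐ g → edgeDist B f g ≡ 0
edgeDist-≐ B (u₁ , u₂) (v₁ , v₂) f≐g rewrite samePair-true f≐g = refl

edgeDist-≤ : (B : Adj n) (f g : Edge n) {p q : Fin n} → p ∈ₑ f → q ∈ₑ g →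
  edgeDist B f g ≤ suc (dist B p q)
edgeDist-≤ B (u₁ , u₂) (v₁ , v₂) p∈f q∈g with samePair u₁ u₂ v₁ v₂
... | true = z≤n
... | false = s≤s (minDist-≤ B (u₁ , u₂) (v₁ , v₂) p∈f q∈g)

edgeDist-sym : (B : Adj n) → Symmetric B → ∀ f g → edgeDist B f g ≡ edgeDist B g f
edgeDist-sym B sy (u₁ , u₂) (v₁ , v₂)
  rewrite samePair-sym u₁ u₂ v₁ v₂
        | dist-sym B sy v₁ u₁ | dist-sym B sy v₁ u₂ | dist-sym B sy v₂ u₁ | dist-sym B sy v₂ u₂
  with samePair u₁ u₂ v₁ v₂
... | true = refl
... | false = cong suc (interchange ⊓-commutativeSemigroup _ _ _ _)

edgeDist-adjacent : (B : Adj n) (f g : Edge n) {p : Fin n} → p ∈ₑ f → p ∈ₑ g → edgeDist B f g ≤ 1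
edgeDist-adjacent B f g {p} p∈f p∈g
  rewrite sym (cong suc (dist-self B p)) = edgeDist-≤ B f g p∈f p∈g

Disjoint : Edge n → Edge n → Set
Disjoint f g = ∀ {p q} → p ∈ₑ f → q ∈ₑ g → p ≢ q

disjoint⇒≭ : (f g : Edge n) → Disjoint f g → ¬ f ≐ g
disjoint⇒≭ f g disjoint ≐-same = disjoint (inj₁ refl) (inj₁ refl) refl
disjoint⇒≭ f g disjoint ≐-flip = disjoint (inj₁ refl) (inj₂ refl) refl

edgeDist-disjoint : (B : Adj n) (f g : Edge n) → Disjoint f g → 2 ≤ edgeDist B f g
edgeDist-disjoint B f g disjoint rewrite edgeDist-≡ B f g (disjoint⇒≭ f g disjoint) =
  s≤s (minDist-glb B f g (λ p∈f q∈g → dist-≢ B _ _ (disjoint p∈f q∈g)))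

MapsInto : (Fin n → Fin n) → Edge n → Edge n → Set
MapsInto ψ f f′ = ψ (proj₁ f) ∈ₑ f′ × ψ (proj₂ f) ∈ₑ f′

edgeDist-nonExpansive : (B C : Adj n) (ψ : Fin n → Fin n) →
  (∀ x y → dist C (ψ x) (ψ y) ≤ dist B x y) →
  ∀ f g f′ g′ → ¬ f ≐ g → MapsInto ψ f f′ → MapsInto ψ g g′ → edgeDist C f′ g′ ≤ edgeDist B f g
edgeDist-nonExpansive {n} B C ψ dist≤ f g f′ g′ f≭g (f₁ , f₂) (g₁ , g₂)
  rewrite edgeDist-≡ B f g f≭g with samePair (proj₁ f′) (proj₂ f′) (proj₁ g′) (proj₂ g′)
... | true = z≤n
... | false = s≤s (minDist-glb B f g bound)
  where
  endpoint : ∀ {p} (e e′ : Edge n) → MapsInto ψ e e′ → p ∈ₑ e → ψ p ∈ₑ e′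
  endpoint e e′ (m₁ , m₂) (inj₁ refl) = m₁
  endpoint e e′ (m₁ , m₂) (inj₂ refl) = m₂
  bound : ∀ {p q} → p ∈ₑ f → q ∈ₑ g → minDist C f′ g′ ≤ dist B p q
  bound p∈f q∈g = ≤-trans (minDist-≤ C f′ g′ (endpoint f f′ (f₁ , f₂) p∈f) (endpoint g g′ (g₁ , g₂) q∈g))
                          (dist≤ _ _)

module _ {X : Set} (h : X × X → ℕ) where

  pairSum : List X → ℕ
  pairSum xs = sum (map h (pairs xs))

  rowSum : X → List X → ℕ
  rowSum x ys = sum (map (λ y → h (x , y)) ys)

  pairSum-cons : ∀ x xs → pairSum (x ∷ xs) ≡ rowSum x xs + pairSum xs
  pairSum-cons x xs = begin
    sum (map h (map (x ,_) xs ++ pairs xs))           ≡⟨ cong sum (map-++ h (map (x ,_) xs) (pairs xs)) ⟩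
    sum (map h (map (x ,_) xs) ++ map h (pairs xs))   ≡⟨ sum-++ (map h (map (x ,_) xs)) _ ⟩
    sum (map h (map (x ,_) xs)) + pairSum xs          ≡⟨ cong (λ l → sum l + pairSum xs) (sym (map-∘ xs)) ⟩
    rowSum x xs + pairSum xs                          ∎
    where open ≡-Reasoning

  rowSum-↭ : ∀ x {xs ys} → xs ↭ ys → rowSum x xs ≡ rowSum x ys
  rowSum-↭ x p = sum-↭ (map⁺ (λ y → h (x , y)) p)

  pairSum-↭ : (∀ x y → h (x , y) ≡ h (y , x)) → ∀ {xs ys} → xs ↭ ys → pairSum xs ≡ pairSum ys
  pairSum-↭ h-sym refl = refl
  pairSum-↭ h-sym (prep {xs} {ys} x p) = begin
    pairSum (x ∷ xs)             ≡⟨ pairSum-cons x xs ⟩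
    rowSum x xs + pairSum xs     ≡⟨ cong₂ _+_ (rowSum-↭ x p) (pairSum-↭ h-sym p) ⟩
    rowSum x ys + pairSum ys     ≡⟨ sym (pairSum-cons x ys) ⟩
    pairSum (x ∷ ys)             ∎
    where open ≡-Reasoning
  pairSum-↭ h-sym (swap {xs} {ys} x y p) = begin
    pairSum (x ∷ y ∷ xs)
      ≡⟨ pairSum-cons x (y ∷ xs) ⟩
    rowSum x (y ∷ xs) + pairSum (y ∷ xs)
      ≡⟨ cong (rowSum x (y ∷ xs) +_) (pairSum-cons y xs) ⟩
    (h (x , y) + rowSum x xs) + (rowSum y xs + pairSum xs)
      ≡⟨ interchange +-commutativeSemigroup (h (x , y)) _ _ _ ⟩
    (h (x , y) + rowSum y xs) + (rowSum x xs + pairSum xs)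
      ≡⟨ cong₂ _+_ (cong₂ _+_ (h-sym x y) (rowSum-↭ y p))
                   (cong₂ _+_ (rowSum-↭ x p) (pairSum-↭ h-sym p)) ⟩
    (h (y , x) + rowSum y ys) + (rowSum x ys + pairSum ys)
      ≡⟨ cong (rowSum y (x ∷ ys) +_) (sym (pairSum-cons x ys)) ⟩
    rowSum y (x ∷ ys) + pairSum (x ∷ ys)
      ≡⟨ sym (pairSum-cons y (x ∷ ys)) ⟩
    pairSum (y ∷ x ∷ ys) ∎
    where open ≡-Reasoning
  pairSum-↭ h-sym (↭-trans p q) = trans (pairSum-↭ h-sym p) (pairSum-↭ h-sym q)

module _ {X : Set} where

  sum-map-mono : (f g : X → ℕ) (xs : List X) → (∀ {x} → x ∈ xs → f x ≤ g x) →
    sum (map f xs) ≤ sum (map g xs)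
  sum-map-mono f g [] f≤g = z≤n
  sum-map-mono f g (x ∷ xs) f≤g = +-mono-≤ (f≤g (here refl)) (sum-map-mono f g xs (λ m → f≤g (there m)))

  pairSum-mono : (h h′ : X × X → ℕ) (xs : List X) →
    (∀ {x y} → x ∈ xs → y ∈ xs → h′ (x , y) ≤ h (x , y)) → pairSum h′ xs ≤ pairSum h xs
  pairSum-mono h h′ [] h′≤h = z≤n
  pairSum-mono h h′ (x ∷ xs) h′≤h = begin
    pairSum h′ (x ∷ xs)              ≡⟨ pairSum-cons h′ x xs ⟩
    rowSum h′ x xs + pairSum h′ xs   ≤⟨ +-mono-≤ (sum-map-mono _ _ xs (λ m → h′≤h (here refl) (there m)))
                                                 (pairSum-mono h h′ xs (λ m m′ → h′≤h (there m) (there m′))) ⟩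
    rowSum h x xs + pairSum h xs     ≡⟨ sym (pairSum-cons h x xs) ⟩
    pairSum h (x ∷ xs)               ∎
    where open ≤-Reasoning

  pairSum-exchange : (h h′ : X × X → ℕ) →
    (∀ x y → h (x , y) ≡ h (y , x)) → (∀ x y → h′ (x , y) ≡ h′ (y , x)) →
    ∀ {xs ys} e e′ f f′ L → xs ↭ e ∷ e′ ∷ L → ys ↭ f ∷ f′ ∷ L →
    h′ (f , f′) < h (e , e′) →
    (∀ {l} → l ∈ L → h′ (f , l) ≤ h (e , l)) →
    (∀ {l} → l ∈ L → h′ (f′ , l) ≤ h (e′ , l)) →
    (∀ {l l′} → l ∈ L → l′ ∈ L → h′ (l , l′) ≤ h (l , l′)) →
    pairSum h′ ys < pairSum h xs
  pairSum-exchange h h′ h-sym h′-sym {xs} {ys} e e′ f f′ L xs↭ ys↭ ff′<ee′ f≤e f′≤e′ L≤L = begin-strict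
    pairSum h′ ys                                                   ≡⟨ pairSum-↭ h′ h′-sym ys↭ ⟩
    pairSum h′ (f ∷ f′ ∷ L)                                         ≡⟨ unfold h′ f f′ ⟩
    (h′ (f , f′) + rowSum h′ f L) + (rowSum h′ f′ L + pairSum h′ L)
      <⟨ +-mono-<-≤ (+-mono-<-≤ ff′<ee′ (sum-map-mono _ _ L f≤e))
                    (+-mono-≤ (sum-map-mono _ _ L f′≤e′) (pairSum-mono h h′ L L≤L)) ⟩
    (h (e , e′) + rowSum h e L) + (rowSum h e′ L + pairSum h L)    ≡⟨ unfold h e e′ ⟨
    pairSum h (e ∷ e′ ∷ L)                                          ≡⟨ pairSum-↭ h h-sym xs↭ ⟨
    pairSum h xs                                                    ∎
    where
    open ≤-Reasoning
    unfold : (k : X × X → ℕ) (d d′ : X) →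
      pairSum k (d ∷ d′ ∷ L) ≡ (k (d , d′) + rowSum k d L) + (rowSum k d′ L + pairSum k L)
    unfold k d d′ = trans (pairSum-cons k d (d′ ∷ L)) (cong (rowSum k d (d′ ∷ L) +_) (pairSum-cons k d′ L))

listed : Adj n → Edge n → Bool
listed B (i , j) = (toℕ i <ᵇ toℕ j) ∧ B i j

edges-≡-filter : (B : Adj n) → edges B ≡ filter (T? ∘ listed B) (cartesianProduct (allFin n) (allFin n))
edges-≡-filter {n} B = outer (allFin n)
  where
  row : Fin n → Fin n → List (Edge n)
  row i j = if listed B (i , j) then [ (i , j) ] else []
  inner : ∀ i ys → concatMap (row i) ys ≡ filter (T? ∘ listed B) (map (i ,_) ys)
  inner i [] = refl
  inner i (j ∷ ys) with listed B (i , j)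
  ... | true = cong ((i , j) ∷_) (inner i ys)
  ... | false = inner i ys
  outer : ∀ xs → concatMap (λ i → concatMap (row i) (allFin n)) xs
               ≡ filter (T? ∘ listed B) (cartesianProduct xs (allFin n))
  outer [] = refl
  outer (i ∷ xs) = trans (cong₂ _++_ (inner i (allFin n)) (outer xs))
                         (sym (filter-++ (T? ∘ listed B) (map (i ,_) (allFin n)) _))

∈-edges⁻ : (B : Adj n) {e : Edge n} → e ∈ edges B → T (listed B e)
∈-edges⁻ {n} B e∈ rewrite edges-≡-filter B =
  proj₂ (∈-filter⁻ (T? ∘ listed B) {xs = cartesianProduct (allFin n) (allFin n)} e∈)

∈-edges⁺ : (B : Adj n) (e : Edge n) → T (listed B e) → e ∈ edges B
∈-edges⁺ B (i , j) t rewrite edges-≡-filter B =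
  ∈-filter⁺ (T? ∘ listed B) (∈-cartesianProduct⁺ (∈-allFin i) (∈-allFin j)) t

edges-unique : (B : Adj n) → Unique (edges B)
edges-unique {n} B rewrite edges-≡-filter B =
  filter⁺ (T? ∘ listed B) (cartesianProduct⁺ (allFin⁺ n) (allFin⁺ n))

listed⇒< : (B : Adj n) (i j : Fin n) → T (listed B (i , j)) → toℕ i < toℕ j
listed⇒< B i j t = <ᵇ⇒< (toℕ i) (toℕ j) (proj₁ (to T-∧ t))

listed⇒adj : (B : Adj n) (i j : Fin n) → T (listed B (i , j)) → T (B i j)
listed⇒adj B i j t = proj₂ (to (T-∧ {toℕ i <ᵇ toℕ j}) t)

ordered : Fin n → Fin n → Edge n
ordered a b = if toℕ a <ᵇ toℕ b then (a , b) else (b , a)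

ordered-≐ : (a b : Fin n) → ordered a b ≐ (a , b)
ordered-≐ a b with toℕ a <ᵇ toℕ b
... | true = ≐-same
... | false = ≐-flip

listed-≐⇒ordered : (B : Adj n) (i j a b : Fin n) → T (listed B (i , j)) → (i , j) ≐ (a , b) →
  (i , j) ≡ ordered a b
listed-≐⇒ordered B i j a b t ij≐ab with listed⇒< B i j t | ij≐ab
... | i<j | ≐-same rewrite to T-≡ (<⇒<ᵇ i<j) = refl
... | i<j | ≐-flip with toℕ j <ᵇ toℕ i in j<ᵇi
...   | true = ⊥-elim (<-asym i<j (<ᵇ⇒< (toℕ j) (toℕ i) (from T-≡ j<ᵇi)))
...   | false = refl

listed-ordered : (B : Adj n) (a b : Fin n) → a ≢ b → T (B a b) → T (B b a) → T (listed B (ordered a b))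
listed-ordered B a b a≢b Bab Bba with toℕ a <ᵇ toℕ b in a<ᵇb
... | true = from T-∧ (from T-≡ a<ᵇb , Bab)
... | false = from T-∧ (<⇒<ᵇ b<a , Bba)
  where
  b<a : toℕ b < toℕ a
  b<a with <-cmp (toℕ a) (toℕ b)
  ... | tri< a<b _ _ = ⊥-elim (subst T a<ᵇb (<⇒<ᵇ a<b))
  ... | tri≈ _ a≡b _ = ⊥-elim (a≢b (toℕ-injective a≡b))
  ... | tri> _ _ b<a = b<a

mapsInto-ordered : (ψ : Fin n → Fin n) (a b c d : Fin n) →
  (∀ {x} → x ∈ₑ (a , b) → ψ x ∈ₑ (c , d)) → MapsInto ψ (ordered a b) (ordered c d)
mapsInto-ordered ψ a b c d maps =
  endpoint (inj₁ refl) , endpoint (inj₂ refl)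
  where
  endpoint : ∀ {x} → x ∈ₑ ordered a b → ψ x ∈ₑ ordered c d
  endpoint x∈ = ∈ₑ-resp-≐ (≐-sym (ordered-≐ c d)) (maps (∈ₑ-resp-≐ (ordered-≐ a b) x∈))

edges-↭ : (B C : Adj n) (a b : Fin n) → a ≢ b →
  (∀ {x y} → (x , y) ≐ (a , b) → T (B x y)) →
  (∀ {x y} → (x , y) ≐ (a , b) → ¬ T (C x y)) →
  (∀ x y → ¬ (x , y) ≐ (a , b) → B x y ≡ C x y) →
  edges B ↭ ordered a b ∷ edges C
edges-↭ {n} B C a b a≢b B∋ab C∌ab B≗C =
  ∼bag⇒↭ (unique∧set⇒bag (edges-unique B) (All.tabulate ab∉C ∷ edges-unique C) (mk⇔ ⊆-to ⊆-from))
  where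
  listed-ab : T (listed B (ordered a b))
  listed-ab = listed-ordered B a b a≢b (B∋ab ≐-same) (B∋ab ≐-flip)
  listed-off-ab : ∀ i j → ¬ (i , j) ≐ (a , b) → listed B (i , j) ≡ listed C (i , j)
  listed-off-ab i j ij≭ab = cong ((toℕ i <ᵇ toℕ j) ∧_) (B≗C i j ij≭ab)
  C-off-ab : ∀ i j → T (listed C (i , j)) → ¬ (i , j) ≐ (a , b)
  C-off-ab i j t ij≐ab = C∌ab ij≐ab (listed⇒adj C i j t)
  ab∉C : ∀ {e} → e ∈ edges C → ordered a b ≢ e
  ab∉C {i , j} e∈ refl = C-off-ab i j (∈-edges⁻ C e∈) (ordered-≐ a b)
  ⊆-to : ∀ {e} → e ∈ edges B → e ∈ ordered a b ∷ edges C
  ⊆-to {i , j} e∈ with (i , j) ≐? (a , b)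
  ... | yes ij≐ab = here (listed-≐⇒ordered B i j a b (∈-edges⁻ B e∈) ij≐ab)
  ... | no ij≭ab = there (∈-edges⁺ C (i , j) (subst T (listed-off-ab i j ij≭ab) (∈-edges⁻ B e∈)))
  ⊆-from : ∀ {e} → e ∈ ordered a b ∷ edges C → e ∈ edges B
  ⊆-from (here refl) = ∈-edges⁺ B (ordered a b) listed-ab
  ⊆-from {i , j} (there e∈) =
    ∈-edges⁺ B (i , j) (subst T (sym (listed-off-ab i j (C-off-ab i j (∈-edges⁻ C e∈)))) (∈-edges⁻ C e∈))

adj-≐ : (B : Adj n) → Symmetric B → (x , y) ≐ (a , b) → B x y ≡ B a b
adj-≐ B sy ≐-same = refl
adj-≐ B sy ≐-flip = sy _ _

module _ (B : Adj n) (a b : Fin n) where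

  deleteEdge-≐ : (x , y) ≐ (a , b) → deleteEdge a b B x y ≡ false
  deleteEdge-≐ {x} {y} xy≐ab rewrite samePair-true xy≐ab = refl

  deleteEdge-≭ : ¬ (x , y) ≐ (a , b) → deleteEdge a b B x y ≡ B x y
  deleteEdge-≭ {x} {y} xy≭ab rewrite samePair-false xy≭ab = refl

  deleteEdge-⊆ : ∀ x y → T (deleteEdge a b B x y) → T (B x y)
  deleteEdge-⊆ x y t with samePair x y a b
  ... | false = t

  addEdge-≐ : (x , y) ≐ (a , b) → T (addEdge a b B x y)
  addEdge-≐ {x} {y} xy≐ab rewrite samePair-true xy≐ab = tt

  addEdge-≭ : ¬ (x , y) ≐ (a , b) → addEdge a b B x y ≡ B x y
  addEdge-≭ {x} {y} xy≭ab rewrite samePair-false xy≭ab = refl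

  addEdge-⊇ : ∀ x y → T (B x y) → T (addEdge a b B x y)
  addEdge-⊇ x y t with samePair x y a b
  ... | true = tt
  ... | false = t

  deleteEdge-symmetric : Symmetric B → Symmetric (deleteEdge a b B)
  deleteEdge-symmetric sy x y rewrite samePair-swapˡ x y a b | sy x y = refl

  addEdge-symmetric : Symmetric B → Symmetric (addEdge a b B)
  addEdge-symmetric sy x y rewrite samePair-swapˡ x y a b | sy x y = refl

  edges-deleteEdge : Symmetric B → a ≢ b → T (B a b) → edges B ↭ ordered a b ∷ edges (deleteEdge a b B)
  edges-deleteEdge sy a≢b Bab = edges-↭ B (deleteEdge a b B) a b a≢b
    (λ xy≐ab → subst T (sym (adj-≐ B sy xy≐ab)) Bab)
    (λ xy≐ab → subst T (deleteEdge-≐ xy≐ab))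
    (λ x y xy≭ab → sym (deleteEdge-≭ xy≭ab))

  edges-addEdge : Symmetric B → a ≢ b → ¬ T (B a b) → edges (addEdge a b B) ↭ ordered a b ∷ edges B
  edges-addEdge sy a≢b ¬Bab = edges-↭ (addEdge a b B) B a b a≢b
    addEdge-≐
    (λ xy≐ab t → ¬Bab (subst T (adj-≐ B sy xy≐ab) t))
    (λ x y xy≭ab → addEdge-≭ xy≭ab)

module _ {X : Set} (f : X → ℕ) where

  sum-map-remove : ∀ {x xs} → x ∈ xs →
    ∃[ ys ] sum (map f xs) ≡ f x + sum (map f ys) × (∀ {y} → y ∈ xs → y ≢ x → y ∈ ys)
  sum-map-remove {xs = x ∷ xs} (here refl) = xs , refl , λ where
    (here refl) y≢x → ⊥-elim (y≢x refl)
    (there y∈) _ → y∈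
  sum-map-remove {x} {z ∷ xs} (there x∈) with sum-map-remove x∈
  ... | ys , sum≡ , kept = z ∷ ys , sum≡′ , kept′
    where
    sum≡′ : f z + sum (map f xs) ≡ f x + (f z + sum (map f ys))
    sum≡′ = trans (cong (f z +_) sum≡) (x∙yz≈y∙xz +-commutativeSemigroup (f z) (f x) _)
    kept′ : ∀ {y} → y ∈ z ∷ xs → y ≢ x → y ∈ z ∷ ys
    kept′ (here refl) _ = here refl
    kept′ (there y∈) y≢x = there (kept y∈ y≢x)

  three-≤-sum-map : ∀ {a b c xs} → a ∈ xs → b ∈ xs → c ∈ xs → b ≢ a → c ≢ a → c ≢ b →
    f a + (f b + f c) ≤ sum (map f xs)
  three-≤-sum-map a∈ b∈ c∈ b≢a c≢a c≢b with sum-map-remove a∈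
  ... | ys , sum≡₁ , kept₁ with sum-map-remove (kept₁ b∈ b≢a)
  ... | zs , sum≡₂ , kept₂ with sum-map-remove (kept₂ (kept₁ c∈ c≢a) c≢b)
  ... | ws , sum≡₃ , _ rewrite sum≡₁ | sum≡₂ | sum≡₃ =
    +-monoʳ-≤ (f _) (+-monoʳ-≤ (f _) (m≤m+n (f _) (sum (map f ws))))

degree-two-neighbours : (B : Adj n) (v a b c : Fin n) → degree B v ≡ 2 →
  T (B v a) → T (B v b) → a ≢ b → T (B v c) → c ≡ a ⊎ c ≡ b
degree-two-neighbours {n} B v a b c deg≡2 Bva Bvb a≢b Bvc with c ≟ a | c ≟ b
... | yes c≡a | _ = inj₁ c≡a
... | no _ | yes c≡b = inj₂ c≡b
... | no c≢a | no c≢b = ⊥-elim (3≰2 (subst (3 ≤_) deg≡2 three≤deg))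
  where
  indicator : Fin n → ℕ
  indicator w = if B v w then 1 else 0
  indicator-1 : ∀ {w} → T (B v w) → indicator w ≡ 1
  indicator-1 t rewrite to T-≡ t = refl
  three≤deg : 3 ≤ degree B v
  three≤deg = subst (_≤ degree B v)
    (cong₂ _+_ (indicator-1 Bva) (cong₂ _+_ (indicator-1 Bvb) (indicator-1 Bvc)))
    (three-≤-sum-map indicator (∈-allFin a) (∈-allFin b) (∈-allFin c) (≢-sym a≢b) c≢a c≢b)
  3≰2 : ¬ 3 ≤ 2
  3≰2 (s≤s (s≤s ()))

degree-two-nonadjacent : (B : Adj n) (u x y w : Fin n) → degree B u ≡ 2 →
  T (B u x) → T (B u y) → x ≢ y → w ≢ x → w ≢ y → ¬ T (B u w)
degree-two-nonadjacent B u x y w deg≡2 Bux Buy x≢y w≢x w≢y Buw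
  with degree-two-neighbours B u x y w deg≡2 Bux Buy x≢y Buw
... | inj₁ w≡x = w≢x w≡x
... | inj₂ w≡y = w≢y w≡y

-- a, b, c, p, q play the roles of v₁, v₂, v₃, v_{r-1}, v_r.
module Reattach (A : Adj n) (sy : Symmetric A) (a b c p q : Fin n)
  (a≢b : a ≢ b) (a≢c : a ≢ c) (a≢p : a ≢ p) (a≢q : a ≢ q) (b≢c : b ≢ c)
  (b≢p : b ≢ p) (b≢q : b ≢ q) (c≢p : c ≢ p) (c≢q : c ≢ q) (p≢q : p ≢ q)
  (Abc : T (A b c)) (Apq : T (A p q)) (¬Aca : ¬ T (A c a)) (¬Apa : ¬ T (A p a))
  (nbrs-b : ∀ y → T (A b y) → y ≡ a ⊎ y ≡ c)
  (nbrs-q : ∀ y → T (A q y) → y ≡ p ⊎ y ≡ a) where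

  A₁ D A₂ A′ : Adj n
  A₁ = deleteEdge p q A
  D = deleteEdge b c A₁
  A₂ = addEdge p a D
  A′ = addEdge c a A₂

  sy₁ : Symmetric A₁
  sy₁ = deleteEdge-symmetric A p q sy
  syD : Symmetric D
  syD = deleteEdge-symmetric A₁ b c sy₁
  sy₂ : Symmetric A₂
  sy₂ = addEdge-symmetric D p a syD
  sy′ : Symmetric A′
  sy′ = addEdge-symmetric A₂ c a sy₂

  D⊆A : ∀ x y → T (D x y) → T (A x y)
  D⊆A x y t = deleteEdge-⊆ A p q x y (deleteEdge-⊆ A₁ b c x y t)

  D∌pq : ∀ {x y} → (x , y) ≐ (p , q) → ¬ T (D x y)
  D∌pq {x} {y} xy≐pq t = subst T (deleteEdge-≐ A p q xy≐pq) (deleteEdge-⊆ A₁ b c x y t)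

  D∌bc : ∀ {x y} → (x , y) ≐ (b , c) → ¬ T (D x y)
  D∌bc xy≐bc = subst T (deleteEdge-≐ A₁ b c xy≐bc)

  edges-A : edges A ↭ ordered p q ∷ ordered b c ∷ edges D
  edges-A = ↭-trans (edges-deleteEdge A p q sy p≢q Apq)
                    (prep (ordered p q) (edges-deleteEdge A₁ b c sy₁ b≢c A₁bc))
    where
    A₁bc : T (A₁ b c)
    A₁bc = subst T (sym (deleteEdge-≭ A p q bc≭pq)) Abc
      where
      bc≭pq : ¬ (b , c) ≐ (p , q)
      bc≭pq ≐-same = b≢p refl
      bc≭pq ≐-flip = b≢q refl

  edges-A′ : edges A′ ↭ ordered p a ∷ ordered c a ∷ edges D
  edges-A′ = ↭-trans (edges-addEdge A₂ c a sy₂ (≢-sym a≢c) ¬A₂ca)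
               (↭-trans (prep (ordered c a) (edges-addEdge D p a syD (≢-sym a≢p) ¬Dpa))
                        (swap (ordered c a) (ordered p a) refl))
    where
    ¬Dpa : ¬ T (D p a)
    ¬Dpa t = ¬Apa (D⊆A p a t)
    ¬A₂ca : ¬ T (A₂ c a)
    ¬A₂ca t = ¬Aca (D⊆A c a (subst T (addEdge-≭ D p a ca≭pa) t))
      where
      ca≭pa : ¬ (c , a) ≐ (p , a)
      ca≭pa ≐-same = c≢p refl
      ca≭pa ≐-flip = a≢c refl

  ψ : Fin n → Fin n
  ψ x = if (x == b) ∨ (x == q) then a else x

  ψb : ψ b ≡ a
  ψb rewrite ==-refl b = refl

  ψq : ψ q ≡ a
  ψq rewrite ==-≢ (≢-sym b≢q) | ==-refl q = refl

  ψ-fixed : ∀ {x} → x ≢ b → x ≢ q → ψ x ≡ x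
  ψ-fixed x≢b x≢q rewrite ==-≢ x≢b | ==-≢ x≢q = refl

  data Fold (x : Fin n) : Set where
    at-b : x ≡ b → Fold x
    at-q : x ≡ q → Fold x
    fixed : x ≢ b → x ≢ q → Fold x

  fold : ∀ x → Fold x
  fold x with x ≟ b | x ≟ q
  ... | yes x≡b | _ = at-b x≡b
  ... | no _ | yes x≡q = at-q x≡q
  ... | no x≢b | no x≢q = fixed x≢b x≢q

  A′-keeps : ∀ {x y} → x ≢ b → x ≢ q → y ≢ b → y ≢ q → T (A x y) → T (A′ x y)
  A′-keeps {x} {y} x≢b x≢q y≢b y≢q t =
    addEdge-⊇ A₂ c a x y (addEdge-⊇ D p a x y
      (subst T (sym (deleteEdge-≭ A₁ b c xy≭bc)) (subst T (sym (deleteEdge-≭ A p q xy≭pq)) t)))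
    where
    xy≭pq : ¬ (x , y) ≐ (p , q)
    xy≭pq ≐-same = y≢q refl
    xy≭pq ≐-flip = x≢q refl
    xy≭bc : ¬ (x , y) ≐ (b , c)
    xy≭bc ≐-same = x≢b refl
    xy≭bc ≐-flip = y≢b refl

  A′ac : T (A′ a c)
  A′ac = addEdge-≐ A₂ c a ≐-flip

  A′ap : T (A′ a p)
  A′ap = addEdge-⊇ A₂ c a a p (addEdge-≐ D p a ≐-flip)

  Respected : Fin n → Fin n → Set
  Respected x y = ψ x ≡ ψ y ⊎ T (A′ (ψ x) (ψ y))

  respected-sym : ∀ x y → Respected x y → Respected y x
  respected-sym x y (inj₁ ψx≡ψy) = inj₁ (sym ψx≡ψy)
  respected-sym x y (inj₂ t) = inj₂ (subst T (sy′ (ψ x) (ψ y)) t)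

  respected-b : ∀ y → T (A b y) → Respected b y
  respected-b y t with nbrs-b y t
  ... | inj₁ refl = inj₁ (trans ψb (sym (ψ-fixed a≢b a≢q)))
  ... | inj₂ refl rewrite ψb | ψ-fixed (≢-sym b≢c) c≢q = inj₂ A′ac

  respected-q : ∀ y → T (A q y) → Respected q y
  respected-q y t with nbrs-q y t
  ... | inj₁ refl rewrite ψq | ψ-fixed (≢-sym b≢p) p≢q = inj₂ A′ap
  ... | inj₂ refl = inj₁ (trans ψq (sym (ψ-fixed a≢b a≢q)))

  ψ-weakHom : WeakHom A A′ ψ
  ψ-weakHom x y t with fold x | fold y
  ... | at-b refl | _ = respected-b y t
  ... | at-q refl | _ = respected-q y t
  ... | fixed _ _ | at-b refl = respected-sym b x (respected-b x (subst T (sy x b) t))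
  ... | fixed _ _ | at-q refl = respected-sym q x (respected-q x (subst T (sy x q) t))
  ... | fixed x≢b x≢q | fixed y≢b y≢q rewrite ψ-fixed x≢b x≢q | ψ-fixed y≢b y≢q =
    inj₂ (A′-keeps x≢b x≢q y≢b y≢q t)

  ψ-endpoint : ∀ x y → T (D x y) → ψ x ∈ₑ (x , y)
  ψ-endpoint x y t with fold x
  ... | at-b refl with nbrs-b y (D⊆A b y t)
  ...   | inj₁ refl = inj₂ ψb
  ...   | inj₂ refl = ⊥-elim (D∌bc ≐-same t)
  ψ-endpoint x y t | at-q refl with nbrs-q y (D⊆A q y t)
  ...   | inj₁ refl = ⊥-elim (D∌pq ≐-flip t)
  ...   | inj₂ refl = inj₂ ψq
  ψ-endpoint x y t | fixed x≢b x≢q = inj₁ (ψ-fixed x≢b x≢q)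

  ψ-maps-D : ∀ {l} → l ∈ edges D → MapsInto ψ l l
  ψ-maps-D {x , y} l∈ = ψ-endpoint x y t , ∈ₑ-resp-≐ ≐-flip (ψ-endpoint y x (subst T (syD x y) t))
    where
    t : T (D x y)
    t = listed⇒adj D x y (∈-edges⁻ D l∈)

  ψ-maps-pq : MapsInto ψ (ordered p q) (ordered p a)
  ψ-maps-pq = mapsInto-ordered ψ p q p a λ where
    (inj₁ refl) → inj₁ (ψ-fixed (≢-sym b≢p) p≢q)
    (inj₂ refl) → inj₂ ψq

  ψ-maps-bc : MapsInto ψ (ordered b c) (ordered c a)
  ψ-maps-bc = mapsInto-ordered ψ b c c a λ where
    (inj₁ refl) → inj₂ ψb
    (inj₂ refl) → inj₁ (ψ-fixed (≢-sym b≢c) c≢q)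

  edgeDist-ψ : ∀ f g f′ g′ → ¬ f ≐ g → MapsInto ψ f f′ → MapsInto ψ g g′ →
    edgeDist A′ f′ g′ ≤ edgeDist A f g
  edgeDist-ψ = edgeDist-nonExpansive A A′ ψ (dist-weakHom A A′ ψ ψ-weakHom)

  ordered-≭-D : (x₀ y₀ : Fin n) → (∀ {x y} → (x , y) ≐ (x₀ , y₀) → ¬ T (D x y)) →
    ∀ {l} → l ∈ edges D → ¬ ordered x₀ y₀ ≐ l
  ordered-≭-D x₀ y₀ D∌ {x , y} l∈ o≐l =
    D∌ (≐-trans (≐-sym o≐l) (ordered-≐ x₀ y₀)) (listed⇒adj D x y (∈-edges⁻ D l∈))

  new-edges-closer : edgeDist A′ (ordered p a) (ordered c a) < edgeDist A (ordered p q) (ordered b c)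
  new-edges-closer = ≤-<-trans
    (edgeDist-adjacent A′ (ordered p a) (ordered c a) (a∈ordered p a (inj₂ refl)) (a∈ordered c a (inj₂ refl)))
    (edgeDist-disjoint A (ordered p q) (ordered b c) disjoint)
    where
    a∈ordered : ∀ {x} u v → x ∈ₑ (u , v) → x ∈ₑ ordered u v
    a∈ordered u v = ∈ₑ-resp-≐ (≐-sym (ordered-≐ u v))
    disjoint : Disjoint (ordered p q) (ordered b c)
    disjoint x∈ y∈ with ∈ₑ-resp-≐ (ordered-≐ p q) x∈ | ∈ₑ-resp-≐ (ordered-≐ b c) y∈
    ... | inj₁ refl | inj₁ refl = ≢-sym b≢p
    ... | inj₁ refl | inj₂ refl = ≢-sym c≢p
    ... | inj₂ refl | inj₁ refl = ≢-sym b≢q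
    ... | inj₂ refl | inj₂ refl = ≢-sym c≢q

  We-decreases : We A′ < We A
  We-decreases = pairSum-exchange (edgePairDist A) (edgePairDist A′)
    (λ f g → edgeDist-sym A sy f g) (λ f g → edgeDist-sym A′ sy′ f g)
    (ordered p q) (ordered b c) (ordered p a) (ordered c a) (edges D) edges-A edges-A′
    new-edges-closer
    (λ l∈ → edgeDist-ψ _ _ _ _ (ordered-≭-D p q D∌pq l∈) ψ-maps-pq (ψ-maps-D l∈))
    (λ l∈ → edgeDist-ψ _ _ _ _ (ordered-≭-D b c D∌bc l∈) ψ-maps-bc (ψ-maps-D l∈))
    D-pairs
    where
    edgePairDist : Adj n → Edge n × Edge n → ℕ
    edgePairDist B (f , g) = edgeDist B f g
    D-pairs : ∀ {l l′} → l ∈ edges D → l′ ∈ edges D → edgeDist A′ l l′ ≤ edgeDist A l l′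
    D-pairs {l} {l′} l∈ l′∈ with l ≐? l′
    ... | yes l≐l′ = ≤-reflexive (trans (edgeDist-≐ A′ l l′ l≐l′) (sym (edgeDist-≐ A l l′ l≐l′)))
    ... | no l≭l′ = edgeDist-ψ l l′ l l′ l≭l′ (ψ-maps-D l∈) (ψ-maps-D l′∈)

-- Here r = 5 + s, and w k = v (suc k) indexes the cycle from 0; range-vᵢ bounds the index of vᵢ.
module EndBlock (A : Adj n) (sy : Symmetric A) (s : ℕ) (v : ℕ → Fin n)
  (inj : ∀ i j → 1 ≤ i → i ≤ 5 + s → 1 ≤ j → j ≤ 5 + s → v i ≡ v j → i ≡ j)
  (cyc : ∀ i → 1 ≤ i → i < 5 + s → A (v i) (v (suc i)) ≡ true)
  (cl : A (v (5 + s)) (v 1) ≡ true)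
  (deg : ∀ i → 2 ≤ i → i ≤ 5 + s → degree A (v i) ≡ 2) where

  w : ℕ → Fin n
  w k = v (suc k)

  w-injective : ∀ {i j} → i ≤ 4 + s → j ≤ 4 + s → i ≢ j → w i ≢ w j
  w-injective i≤ j≤ i≢j = i≢j ∘ suc-injective ∘ inj _ _ (s≤s z≤n) (s≤s i≤) (s≤s z≤n) (s≤s j≤)

  cycle-edge : ∀ {k} → k < 4 + s → T (A (w k) (w (suc k)))
  cycle-edge k< = from T-≡ (cyc _ (s≤s z≤n) (s≤s k<))

  cycle-edge⁻ : ∀ {k} → k < 4 + s → T (A (w (suc k)) (w k))
  cycle-edge⁻ k< = subst T (sy _ _) (cycle-edge k<)

  degree-w : ∀ {k} → suc k ≤ 4 + s → degree A (w (suc k)) ≡ 2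
  degree-w k< = deg _ (s≤s (s≤s z≤n)) (s≤s k<)

  v₁ v₂ v₃ v₄ vᵣ₋₂ vᵣ₋₁ vᵣ : Fin n
  v₁ = w 0
  v₂ = w 1
  v₃ = w 2
  v₄ = w 3
  vᵣ₋₂ = w (2 + s)
  vᵣ₋₁ = w (3 + s)
  vᵣ = w (4 + s)

  range-v₂ : 1 ≤ 4 + s
  range-v₂ = s≤s z≤n
  range-v₃ : 2 ≤ 4 + s
  range-v₃ = s≤s (s≤s z≤n)
  range-v₄ : 3 ≤ 4 + s
  range-v₄ = s≤s (s≤s (s≤s z≤n))
  range-vᵣ₋₂ : 2 + s ≤ 4 + s
  range-vᵣ₋₂ = m≤n+m (2 + s) 2
  range-vᵣ₋₁ : 3 + s ≤ 4 + s
  range-vᵣ₋₁ = n≤1+n (3 + s)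
  range-vᵣ : 4 + s ≤ 4 + s
  range-vᵣ = ≤-refl

  We-decreases : We (addEdge v₃ v₁ (addEdge vᵣ₋₁ v₁ (deleteEdge v₂ v₃ (deleteEdge vᵣ₋₁ vᵣ A)))) < We A
  We-decreases = Reattach.We-decreases A sy v₁ v₂ v₃ vᵣ₋₁ vᵣ
    v₁≢v₂ v₁≢v₃ v₁≢vᵣ₋₁ v₁≢vᵣ v₂≢v₃ v₂≢vᵣ₋₁ v₂≢vᵣ v₃≢vᵣ₋₁ v₃≢vᵣ vᵣ₋₁≢vᵣ
    (cycle-edge range-v₃) (cycle-edge range-vᵣ)
    (degree-two-nonadjacent A v₃ v₂ v₄ v₁ (degree-w range-v₃)
      (cycle-edge⁻ range-v₃) (cycle-edge range-v₄) v₂≢v₄ v₁≢v₂ v₁≢v₄)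
    (degree-two-nonadjacent A vᵣ₋₁ vᵣ₋₂ vᵣ v₁ (degree-w range-vᵣ₋₁)
      (cycle-edge⁻ range-vᵣ₋₁) (cycle-edge range-vᵣ) vᵣ₋₂≢vᵣ v₁≢vᵣ₋₂ v₁≢vᵣ)
    (λ y → degree-two-neighbours A v₂ v₁ v₃ y (degree-w range-v₂)
      (cycle-edge⁻ range-v₂) (cycle-edge range-v₃) v₁≢v₃)
    (λ y → degree-two-neighbours A vᵣ vᵣ₋₁ v₁ y (degree-w range-vᵣ)
      (cycle-edge⁻ range-vᵣ) (from T-≡ cl) (≢-sym v₁≢vᵣ₋₁))
    where
    v₁≢v₂ = w-injective z≤n range-v₂ λ ()
    v₁≢v₃ = w-injective z≤n range-v₃ λ ()
    v₁≢v₄ = w-injective z≤n range-v₄ λ ()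
    v₁≢vᵣ₋₂ = w-injective z≤n range-vᵣ₋₂ λ ()
    v₁≢vᵣ₋₁ = w-injective z≤n range-vᵣ₋₁ λ ()
    v₁≢vᵣ = w-injective z≤n range-vᵣ λ ()
    v₂≢v₃ = w-injective range-v₂ range-v₃ λ ()
    v₂≢v₄ = w-injective range-v₂ range-v₄ λ ()
    v₂≢vᵣ₋₁ = w-injective range-v₂ range-vᵣ₋₁ λ ()
    v₂≢vᵣ = w-injective range-v₂ range-vᵣ λ ()
    v₃≢vᵣ₋₁ = w-injective range-v₃ range-vᵣ₋₁ λ ()
    v₃≢vᵣ = w-injective range-v₃ range-vᵣ λ ()
    vᵣ₋₂≢vᵣ = w-injective range-vᵣ₋₂ range-vᵣ (<⇒≢ range-vᵣ₋₁)
    vᵣ₋₁≢vᵣ = w-injective range-vᵣ₋₁ range-vᵣ (<⇒≢ range-vᵣ)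

lemma6 : (n : ℕ) (A : Adj n) → Symmetric A → Loopless A → Connected A →
    (r : ℕ) → 5 ≤ r → (v : ℕ → Fin n) →
    -- v 1, …, v r are distinct vertices
    (∀ i j → 1 ≤ i → i ≤ r → 1 ≤ j → j ≤ r → v i ≡ v j → i ≡ j) →
    -- C_r = v₁ v₂ ⋯ v_r v₁ is a cycle of G
    (∀ i → 1 ≤ i → i < r → A (v i) (v (suc i)) ≡ true) →
    A (v r) (v 1) ≡ true →
    -- v₂, …, v_r have degree 2 in G (end-block attached at v₁)
    (∀ i → 2 ≤ i → i ≤ r → degree A (v i) ≡ 2) →
    2 ≤ degree A (v 1) →
    We (addEdge (v 3) (v 1) (addEdge (v (r ∸ 1)) (v 1)
         (deleteEdge (v 2) (v 3) (deleteEdge (v (r ∸ 1)) (v r) A))))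
      < We A
lemma6 n A sy _ _ _ (s≤s (s≤s (s≤s (s≤s (s≤s {n = s} z≤n))))) v inj cyc cl deg _ =
  EndBlock.We-decreases A sy s v inj cyc cl deg
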